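{- For every simple graph $G$ of order $n\ge 2$, $\chi\big(S[G,2]\big)=\chi(G)$, where $\chi$ denotes the chromatic number.
   Context: Let $G$ be a simple graph with vertex set $V=\{1,\dots,n\}$, $n\ge 2$. The generalized Sierpiński graph $S(G,2)$ has vertex set $V^2$ (words $u_1u_2$); $u_1u_2$ and $v_1v_2$ are adjacent iff either $u_1=v_1$ and $u_2v_2\in E(G)$, or $u_1\ne v_1$, $u_1v_1\in E(G)$, $u_2=v_1$ and $v_2=u_1$. The edges of the second kind (joining $ab$ and $ba$ for $ab\in E(G)$) are the linking edges. The generalized Sierpiński gasket $S[G,2]$ is obtained from $S(G,2)$ by contracting all linking edges; the vertex obtained from contracting the edge between $ab$ and $ba$ is denoted $\{a,b\}_2$. -}

module Defs where

open import Data.Nat using (ℕ; _≤_; _≤ᵇ_)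
open import Data.Fin using (Fin; toℕ)
open import Data.Bool using (Bool; true; false; if_then_else_)
open import Data.Product using (Σ; ∃; ∃-syntax; _×_; _,_; proj₁)
open import Data.Sum using (_⊎_)
open import Relation.Binary.PropositionalEquality using (_≡_; _≢_)
open import Relation.Nullary using (¬_)

record Graph : Set₁ where
  field
    Vertex : Set
    Adj    : Vertex → Vertex → Set
open Graph public

record SimpleGraph (n : ℕ) : Set where
  field
    adj    : Fin n → Fin n → Bool
    sym    : ∀ a b → adj a b ≡ adj b a
    irrefl : ∀ a → adj a a ≡ false
open SimpleGraph public

toGraph : ∀ {n} → SimpleGraph n → Graph
toGraph {n} G = record { Vertex = Fin n ; Adj = λ a b → adj G a b ≡ true }

ProperColouring : (H : Graph) (k : ℕ) → (Vertex H → Fin k) → Set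
ProperColouring H k c = ∀ x y → Adj H x y → c x ≢ c y

Colourable : Graph → ℕ → Set
Colourable H k = ∃[ c ] ProperColouring H k c

IsChromaticNumber : Graph → ℕ → Set
IsChromaticNumber H k = Colourable H k × (∀ j → Colourable H j → k ≤ j)

Word2 : ℕ → Set
Word2 n = Fin n × Fin n

SAdj : ∀ {n} → SimpleGraph n → Word2 n → Word2 n → Set
SAdj G (u₁ , u₂) (v₁ , v₂) =
  (u₁ ≡ v₁ × adj G u₂ v₂ ≡ true)
  ⊎ (u₁ ≢ v₁ × adj G u₁ v₁ ≡ true × u₂ ≡ v₁ × v₂ ≡ u₁)

Sierpinski2 : ∀ {n} → SimpleGraph n → Graph
Sierpinski2 {n} G = record { Vertex = Word2 n ; Adj = SAdj G }

-- Contracting the linking edges: each class {ab, ba} (ab ∈ E(G)) is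
-- represented by the word with the smaller first letter; every other
-- word forms a singleton class.  `norm` sends a word to its class representative.
norm : ∀ {n} → SimpleGraph n → Word2 n → Word2 n
norm G (a , b) =
  if adj G a b
  then (if toℕ a ≤ᵇ toℕ b then (a , b) else (b , a))
  else (a , b)

GasketVertex : ∀ {n} → SimpleGraph n → Set
GasketVertex {n} G = Σ (Word2 n) (λ w → norm G w ≡ w)

GasketAdj : ∀ {n} (G : SimpleGraph n) → GasketVertex G → GasketVertex G → Set
GasketAdj G x y =
  proj₁ x ≢ proj₁ y
  × ∃[ u ] ∃[ v ] (SAdj G u v × norm G u ≡ proj₁ x × norm G v ≡ proj₁ y)

SierpinskiGasket2 : ∀ {n} → SimpleGraph n → Graph
SierpinskiGasket2 G = record { Vertex = GasketVertex G ; Adj = GasketAdj G }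

{-# OPTIONS --safe #-}
-- Restricting to a single copy {a}×V of S[G,2] embeds G, so χ(G) ≤ χ(S[G,2]).
-- Conversely, every edge of S[G,2] lies inside a copy (the linking edges have
-- been contracted), so if c properly colours G with k colours then
-- {a,b} ↦ c(a) + c(b) mod k is well defined and properly colours S[G,2]:
-- inside copy a it is c shifted by c(a).
module Submission where

open import Defs hiding (sym)
open import Data.Nat using (ℕ; suc; _+_; _*_; _%_; _≤_; _≤ᵇ_; s≤s)
open import Data.Nat.Properties using (≤ᵇ-reflects-≤; ≤-antisym; ≤-total; +-comm)
open import Data.Nat.DivMod using (m%n<n; m<n⇒m%n≡m; %-distribˡ-+; [m+kn]%n≡m%n)
open import Data.Nat.Tactic.RingSolver using (solve-∀)
open import Data.Fin using (Fin; toℕ; fromℕ<) renaming (zero to fzero)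
open import Data.Fin.Properties using (toℕ-injective; toℕ-fromℕ<; toℕ<n)
open import Data.Bool using (true; false)
open import Data.Product using (Σ; ∃-syntax; _×_; _,_; proj₁)
open import Data.Product.Properties using (,-injectiveˡ; ,-injectiveʳ)
open import Data.Sum using (_⊎_; inj₁; inj₂)
open import Function.Bundles using (_⇔_; mk⇔)
open import Relation.Binary.PropositionalEquality
  using (_≡_; _≢_; refl; sym; trans; cong; module ≡-Reasoning)
open import Relation.Nullary using (contradiction)
open import Relation.Nullary.Reflects using (ofʸ; ofⁿ)

Homomorphism : Graph → Graph → Set
Homomorphism H H′ =
  Σ (Vertex H → Vertex H′) λ f → ∀ x y → Adj H x y → Adj H′ (f x) (f y)

colourable-comap : ∀ {H H′ k} → Homomorphism H H′ → Colourable H′ k → Colourable H k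
colourable-comap (f , f-hom) (c , c-proper) =
  (λ x → c (f x)) , λ x y xy → c-proper (f x) (f y) (f-hom x y xy)

isChromaticNumber-cong : ∀ {H H′} →
  (∀ {j} → Colourable H j → Colourable H′ j) →
  (∀ {j} → Colourable H′ j → Colourable H j) →
  ∀ {k} → IsChromaticNumber H k ⇔ IsChromaticNumber H′ k
isChromaticNumber-cong to from = mk⇔
  (λ (col , least) → to col , λ j col′ → least j (from col′))
  (λ (col , least) → from col , λ j col′ → least j (to col′))

%-cancelˡ-+ : ∀ s {x y} m → (s + x) % suc m ≡ (s + y) % suc m → x % suc m ≡ y % suc m
%-cancelˡ-+ s {x} {y} m eq = begin
  x % n                                   ≡⟨ [m+kn]%n≡m%n x s n ⟨
  (x + s * n) % n                         ≡⟨ cong (_% n) (shift x s m) ⟩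
  (s + x + m * s) % n                     ≡⟨ %-distribˡ-+ (s + x) (m * s) n ⟩
  ((s + x) % n + (m * s) % n) % n         ≡⟨ cong (λ r → (r + (m * s) % n) % n) eq ⟩
  ((s + y) % n + (m * s) % n) % n         ≡⟨ %-distribˡ-+ (s + y) (m * s) n ⟨
  (s + y + m * s) % n                     ≡⟨ cong (_% n) (shift y s m) ⟨
  (y + s * n) % n                         ≡⟨ [m+kn]%n≡m%n y s n ⟩
  y % n                                   ∎
  where
  open ≡-Reasoning
  n = suc m
  -- Adding m * s ≡ (n - 1) * s undoes the addition of s modulo n.
  shift : ∀ z t l → z + t * suc l ≡ t + z + l * t
  shift = solve-∀

infixl 6 _⊕_

_⊕_ : ∀ {k} → Fin k → Fin k → Fin k
_⊕_ {suc m} s t = fromℕ< (m%n<n (toℕ s + toℕ t) (suc m))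

⊕-comm : ∀ {k} (s t : Fin k) → s ⊕ t ≡ t ⊕ s
⊕-comm {suc m} s t = toℕ-injective (begin
  toℕ (s ⊕ t)              ≡⟨ toℕ-fromℕ< _ ⟩
  (toℕ s + toℕ t) % suc m  ≡⟨ cong (_% suc m) (+-comm (toℕ s) (toℕ t)) ⟩
  (toℕ t + toℕ s) % suc m  ≡⟨ toℕ-fromℕ< _ ⟨
  toℕ (t ⊕ s)              ∎)
  where open ≡-Reasoning

⊕-cancelˡ : ∀ {k} (s : Fin k) {t t′} → s ⊕ t ≡ s ⊕ t′ → t ≡ t′
⊕-cancelˡ {suc m} s {t} {t′} eq = toℕ-injective (begin
  toℕ t             ≡⟨ m<n⇒m%n≡m (toℕ<n t) ⟨
  toℕ t % suc m     ≡⟨ %-cancelˡ-+ (toℕ s) m eq′ ⟩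
  toℕ t′ % suc m    ≡⟨ m<n⇒m%n≡m (toℕ<n t′) ⟩
  toℕ t′            ∎)
  where
  open ≡-Reasoning
  eq′ : (toℕ s + toℕ t) % suc m ≡ (toℕ s + toℕ t′) % suc m
  eq′ = trans (sym (toℕ-fromℕ< _)) (trans (cong toℕ eq) (toℕ-fromℕ< _))

module _ {n : ℕ} (G : SimpleGraph n) where

  adj⇒≢ : ∀ {a b} → adj G a b ≡ true → a ≢ b
  adj⇒≢ {a} ab refl = contradiction (trans (sym ab) (irrefl G a)) λ ()

  norm-cases : ∀ a b →
    norm G (a , b) ≡ (a , b) ⊎ (adj G a b ≡ true × norm G (a , b) ≡ (b , a))
  norm-cases a b with adj G a b
  ... | false = inj₁ refl
  ... | true with toℕ a ≤ᵇ toℕ b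
  ...   | true  = inj₁ refl
  ...   | false = inj₂ (refl , refl)

  norm-swap : ∀ {a b} → adj G a b ≡ true → norm G (a , b) ≡ norm G (b , a)
  norm-swap {a} {b} ab
    rewrite ab | trans (SimpleGraph.sym G b a) ab
    with toℕ a ≤ᵇ toℕ b | ≤ᵇ-reflects-≤ (toℕ a) (toℕ b)
       | toℕ b ≤ᵇ toℕ a | ≤ᵇ-reflects-≤ (toℕ b) (toℕ a)
  ... | true  | ofʸ a≤b | true  | ofʸ b≤a = contradiction (toℕ-injective (≤-antisym a≤b b≤a)) (adj⇒≢ ab)
  ... | true  | _       | false | _       = refl
  ... | false | _       | true  | _       = refl
  ... | false | ofⁿ a≰b | false | ofⁿ b≰a with ≤-total (toℕ a) (toℕ b)
  ...   | inj₁ a≤b = contradiction a≤b a≰b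
  ...   | inj₂ b≤a = contradiction b≤a b≰a

  norm-idem : ∀ w → norm G (norm G w) ≡ norm G w
  norm-idem (a , b) with norm-cases a b
  ... | inj₁ fixed = cong (norm G) fixed
  ... | inj₂ (ab , swapped) = trans (cong (norm G) swapped) (sym (norm-swap ab))

  norm-injectiveʳ : ∀ {a p q} → norm G (a , p) ≡ norm G (a , q) → p ≡ q
  norm-injectiveʳ {a} {p} {q} eq with norm-cases a p | norm-cases a q
  ... | inj₁ e₁       | inj₁ e₂       = ,-injectiveʳ (trans (sym e₁) (trans eq e₂))
  ... | inj₁ e₁       | inj₂ (_ , e₂) =
    let h = trans (sym e₁) (trans eq e₂) in trans (,-injectiveʳ h) (,-injectiveˡ h)
  ... | inj₂ (_ , e₁) | inj₁ e₂       =
    let h = trans (sym e₁) (trans eq e₂) in trans (,-injectiveˡ h) (,-injectiveʳ h)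
  ... | inj₂ (_ , e₁) | inj₂ (_ , e₂) = ,-injectiveˡ (trans (sym e₁) (trans eq e₂))

  copy : Fin n → Fin n → GasketVertex G
  copy a p = norm G (a , p) , norm-idem (a , p)

  copy-homomorphism : Fin n → Homomorphism (toGraph G) (SierpinskiGasket2 G)
  copy-homomorphism a = copy a , λ p q pq →
    (λ eq → adj⇒≢ pq (norm-injectiveʳ eq)) , (a , p) , (a , q) , inj₁ (refl , pq) , refl , refl

  gasketAdj⇒copyAdj : ∀ x y → GasketAdj G x y →
    ∃[ a ] ∃[ p ] ∃[ q ] (adj G p q ≡ true × norm G (a , p) ≡ proj₁ x × norm G (a , q) ≡ proj₁ y)
  gasketAdj⇒copyAdj _ _ (_ , (a , p) , (.a , q) , inj₁ (refl , pq) , px , qy) =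
    a , p , q , pq , px , qy
  gasketAdj⇒copyAdj _ _ (x≢y , (a , b) , (.b , .a) , inj₂ (_ , ab , refl , refl) , refl , refl) =
    contradiction (norm-swap ab) x≢y

  module _ {k : ℕ} (c : Fin n → Fin k) where

    sumColour : Word2 n → Fin k
    sumColour (a , b) = c a ⊕ c b

    sumColour-norm : ∀ w → sumColour (norm G w) ≡ sumColour w
    sumColour-norm (a , b) with norm-cases a b
    ... | inj₁ fixed rewrite fixed = refl
    ... | inj₂ (_ , swapped) rewrite swapped = ⊕-comm (c b) (c a)

  gasket-colourable : ∀ {k} → Colourable (toGraph G) k → Colourable (SierpinskiGasket2 G) k
  gasket-colourable {k} (c , c-proper) = (λ x → sumColour c (proj₁ x)) , proper
    where
    proper : ProperColouring (SierpinskiGasket2 G) k (λ x → sumColour c (proj₁ x))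
    proper x y xy same with gasketAdj⇒copyAdj x y xy
    ... | a , p , q , pq , refl , refl = c-proper p q pq (⊕-cancelˡ (c a) (begin
      c a ⊕ c p                    ≡⟨ sumColour-norm c (a , p) ⟨
      sumColour c (norm G (a , p)) ≡⟨ same ⟩
      sumColour c (norm G (a , q)) ≡⟨ sumColour-norm c (a , q) ⟩
      c a ⊕ c q                    ∎))
      where open ≡-Reasoning

mainTheorem2 : (n : ℕ) → 2 ≤ n → (G : SimpleGraph n) → (k : ℕ) →
    IsChromaticNumber (SierpinskiGasket2 G) k ⇔ IsChromaticNumber (toGraph G) k
mainTheorem2 (suc _) (s≤s _) G k =
  isChromaticNumber-cong (colourable-comap (copy-homomorphism G fzero)) (gasket-colourable G)
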